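{- Let $n$ be a positive integer, $\alpha\in\{1,\ldots,n\}^n$ and $\beta=(\beta_2,\ldots,\beta_n)\in\{0,1\}^{n-1}$. Suppose that $\alpha$ parks under the choices $\beta$. If $\beta_i=1$ for some $i$, then $\alpha$ also parks under the choices $\beta'$ obtained from $\beta$ by replacing $\beta_i$ with $0$.
   Context: Deterministic $1$-Naples parking with choices: parking spots $1,\ldots,n$ in a line; cars $C_1,\ldots,C_n$ arrive in order, $C_i$ preferring spot $\alpha_i$. Given $\beta=(\beta_2,\ldots,\beta_n)\in\{0,1\}^{n-1}$: car $C_i$ parks at $\alpha_i$ if it is empty. If $\alpha_i$ is occupied and $\beta_i=1$, $C_i$ parks in the first empty spot among $\alpha_i+1,\ldots,n$. If $\alpha_i$ is occupied and $\beta_i=0$, $C_i$ parks at $\alpha_i-1$ if $\alpha_i\ge 2$ and that spot is empty, and otherwise in the first empty spot among $\alpha_i+1,\ldots,n$. A car finding no empty spot fails to park; $\alpha$ parks under $\beta$ if every car parks. -}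

module Defs where

open import Data.Nat using (ℕ; zero; suc)
open import Data.Fin using (Fin; zero; suc; toℕ; inject₁; fromℕ)
open import Data.Bool using (Bool; true; false; if_then_else_)
open import Data.Maybe using (Maybe; just; nothing; _>>=_)
open import Relation.Binary.PropositionalEquality using (_≡_)
open import Data.Product using (∃)
open import Relation.Nullary using (yes; no)

-- Spots 1..n are represented by Fin n (spot k+1 ↦ k); cars C_1..C_n by Fin n.
-- An occupancy state: Occ n = Fin n → Bool  (true = occupied).
Occ : ℕ → Set
Occ n = Fin n → Bool

update : ∀ {n} → Occ n → Fin n → Occ n
update {suc n} o zero zero = true
update {suc n} o zero (suc j) = o (suc j)
update {suc n} o (suc i) zero = o zero
update {suc n} o (suc i) (suc j) = update (λ k → o (suc k)) i j

firstEmpty : ∀ {n} → Occ n → Maybe (Fin n)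
firstEmpty {zero} o = nothing
firstEmpty {suc n} o with o zero
... | false = just zero
... | true  = Data.Maybe.map suc (firstEmpty (λ k → o (suc k)))

firstEmptyAfter : ∀ {n} → Occ n → Fin n → Maybe (Fin n)
firstEmptyAfter {suc n} o zero = Data.Maybe.map suc (firstEmpty (λ k → o (suc k)))
firstEmptyAfter {suc n} o (suc i) = Data.Maybe.map suc (firstEmptyAfter (λ k → o (suc k)) i)

prev : ∀ {n} → Fin n → Maybe (Fin n)
prev zero = nothing
prev (suc i) = just (inject₁ i)

-- one step of the deterministic 1-Naples rule with choice bit c
-- (c = true : β_i = 1, c = false : β_i = 0); returns the spot taken, if any
chooseSpot : ∀ {n} → Occ n → Fin n → Bool → Maybe (Fin n)
chooseSpot o a c with o a
... | false = just a
... | true with c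
...   | true = firstEmptyAfter o a
...   | false with prev a
...     | nothing = firstEmptyAfter o a
...     | just p with o p
...       | false = just p
...       | true  = firstEmptyAfter o a

open import Data.List using (List; []; _∷_)
open import Data.Product using (_×_; _,_)

run : ∀ {n} → Occ n → List (Fin n × Bool) → Maybe (Occ n)
run o [] = just o
run o ((a , c) ∷ rest) = chooseSpot o a c >>= λ s → run (update o s) rest

-- Cars C_1..C_{m+1} (n = m+1); β = (β_2,…,β_{m+1}) : Fin m → Bool, where
-- β j is the bit of car C_{j+2}. Car C_1 always finds its spot empty, so its
-- bit is irrelevant (we pass false).
carList : ∀ {m k} → (Fin k → Fin (suc m)) → (Fin k → Bool) → List (Fin (suc m) × Bool)
carList {k = zero} α c = []
carList {k = suc k} α c = (α zero , c zero) ∷ carList (λ j → α (suc j)) (λ j → c (suc j))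

bitOf : ∀ {m} → (Fin m → Bool) → Fin (suc m) → Bool
bitOf β zero = false
bitOf β (suc j) = β j

empty : ∀ {n} → Occ n
empty _ = false

Parks : ∀ {m} → (Fin (suc m) → Fin (suc m)) → (Fin m → Bool) → Set
Parks {m} α β = ∃ λ o → run (empty {suc m}) (carList α (bitOf β)) ≡ just o

setFalse : ∀ {m} → (Fin m → Bool) → Fin m → (Fin m → Bool)
setFalse β i j with Data.Fin._≟_ i j
... | yes _ = false
... | no _ = β j

module Submission where

-- Run the process under β and under β' side by side. Before the car whose bit
-- is lowered the runs coincide; at that car β' can only differ by parking
-- behind the preferred spot instead of ahead of it. From then on the two
-- occupancies are always a common base plus one car, sitting at `from` in the
-- β-run and at `to ≤ from` in the β'-run ('Shifted'). A case analysis on how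
-- each run places the next car shows this invariant is preserved, and that
-- the β'-run cannot get stuck while the β-run parks: a car stuck in the β'-run
-- finds every spot from its preference on occupied, yet whenever the β-run
-- parks it, the β'-run's hole at `from` lies at or after that preference.

open import Defs
open import Data.Bool using (Bool; true; false)
open import Data.Empty using (⊥-elim)
open import Data.Fin using (Fin; zero; suc; toℕ; _<_; _≤_; _≟_)
open import Data.Fin.Properties using (toℕ-injective; toℕ-inject₁; suc-injective; <-cmp; <⇒≢; ≤∧≢⇒<; ≤-refl)
open import Data.List using (List; []; _∷_)
open import Data.Maybe using (just; nothing)
import Data.Maybe
open import Data.Nat using (ℕ; zero; suc; z≤n; s≤s)
import Data.Nat.Properties as ℕ
open import Data.Product using (_×_; _,_; proj₁; proj₂; ∃)
open import Data.Sum using (_⊎_; inj₁; inj₂)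
open import Function using (_∘_)
open import Relation.Binary.Definitions using (tri<; tri≈; tri>)
open import Relation.Binary.PropositionalEquality
  using (_≡_; _≢_; _≗_; refl; sym; trans; cong; cong₂; subst)
open import Relation.Nullary using (¬_; yes; no)

private variable
  m n : ℕ
  o o' O O' r : Occ n
  a p q s s' : Fin n
  c : Bool
  cars cars' : List (Fin n × Bool)

true≢false : ∀ {b : Bool} → b ≡ true → b ≢ false
true≢false refl ()

update-updates : (o : Occ n) (s : Fin n) → update o s s ≡ true
update-updates {suc n} o zero    = refl
update-updates {suc n} o (suc s) = update-updates (o ∘ suc) s

update-minimal : (o : Occ n) {s k : Fin n} → k ≢ s → update o s k ≡ o k
update-minimal {suc n} o {zero}  {zero}  k≢s = ⊥-elim (k≢s refl)
update-minimal {suc n} o {zero}  {suc k} _   = refl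
update-minimal {suc n} o {suc s} {zero}  _   = refl
update-minimal {suc n} o {suc s} {suc k} k≢s = update-minimal (o ∘ suc) (k≢s ∘ cong suc)

update-cong : (s : Fin n) → o ≗ o' → update o s ≗ update o' s
update-cong {o = o} {o'} s o≗o' k with k ≟ s
... | yes refl = trans (update-updates o s) (sym (update-updates o' s))
... | no k≢s   = trans (update-minimal o k≢s) (trans (o≗o' k) (sym (update-minimal o' k≢s)))

update-comm : (o : Occ n) (s t : Fin n) → update (update o s) t ≗ update (update o t) s
update-comm {suc n} o zero    zero    k       = refl
update-comm {suc n} o zero    (suc t) zero    = refl
update-comm {suc n} o zero    (suc t) (suc k) = refl
update-comm {suc n} o (suc s) zero    zero    = refl
update-comm {suc n} o (suc s) zero    (suc k) = refl
update-comm {suc n} o (suc s) (suc t) zero    = refl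
update-comm {suc n} o (suc s) (suc t) (suc k) = update-comm (o ∘ suc) s t k

FullAfter : Occ n → Fin n → Set
FullAfter o a = ∀ k → a < k → o k ≡ true

record IsFirstEmptyAfter (o : Occ n) (a s : Fin n) : Set where
  constructor isFirstEmptyAfter
  field
    after        : a < s
    vacant       : o s ≡ false
    full-between : ∀ k → a < k → k < s → o k ≡ true

open IsFirstEmptyAfter

firstEmpty-just : (o : Occ n) → firstEmpty o ≡ just s → o s ≡ false × (∀ k → k < s → o k ≡ true)
firstEmpty-just {suc n} o eq with o zero in o₀
firstEmpty-just {suc n} o refl | false = o₀ , λ _ ()
... | true with firstEmpty (λ k → o (suc k)) in e
firstEmpty-just {suc n} o refl | true | just s =
  proj₁ rest , λ { zero _ → o₀ ; (suc k) (s≤s k<s) → proj₂ rest k k<s }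
  where rest = firstEmpty-just (o ∘ suc) e

firstEmpty-nothing : (o : Occ n) → firstEmpty o ≡ nothing → ∀ k → o k ≡ true
firstEmpty-nothing {suc n} o eq k with o zero in o₀
firstEmpty-nothing {suc n} o () k | false
... | true with firstEmpty (λ k → o (suc k)) in e
firstEmpty-nothing {suc n} o refl zero    | true | nothing = o₀
firstEmpty-nothing {suc n} o refl (suc k) | true | nothing = firstEmpty-nothing (o ∘ suc) e k

firstEmptyAfter-just : (o : Occ n) (a : Fin n) → firstEmptyAfter o a ≡ just s → IsFirstEmptyAfter o a s
firstEmptyAfter-just {suc n} o zero eq with firstEmpty (λ k → o (suc k)) in e
firstEmptyAfter-just {suc n} o zero refl | just s =
  isFirstEmptyAfter (s≤s z≤n) (proj₁ rest) λ { (suc k) _ (s≤s k<s) → proj₂ rest k k<s }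
  where rest = firstEmpty-just (o ∘ suc) e
firstEmptyAfter-just {suc n} o (suc a) eq with firstEmptyAfter (λ k → o (suc k)) a in e
firstEmptyAfter-just {suc n} o (suc a) refl | just s =
  isFirstEmptyAfter (s≤s (after rest)) (vacant rest)
    λ { (suc k) (s≤s a<k) (s≤s k<s) → full-between rest k a<k k<s }
  where rest = firstEmptyAfter-just (o ∘ suc) a e

firstEmptyAfter-nothing : (o : Occ n) (a : Fin n) → firstEmptyAfter o a ≡ nothing → FullAfter o a
firstEmptyAfter-nothing {suc n} o zero eq k a<k with firstEmpty (λ k → o (suc k)) in e
firstEmptyAfter-nothing {suc n} o zero refl (suc k) _ | nothing = firstEmpty-nothing (o ∘ suc) e k
firstEmptyAfter-nothing {suc n} o (suc a) eq k a<k with firstEmptyAfter (λ k → o (suc k)) a in e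
firstEmptyAfter-nothing {suc n} o (suc a) refl (suc k) (s≤s a<k) | nothing =
  firstEmptyAfter-nothing (o ∘ suc) a e k a<k

firstEmptyAfter-minimal : IsFirstEmptyAfter o a s → a < q → o q ≡ false → s ≤ q
firstEmptyAfter-minimal {q = q} first a<q o-q =
  ℕ.≮⇒≥ λ q<s → true≢false (full-between first q a<q q<s) o-q

firstEmpty-cong : ∀ {n} {o o' : Occ n} → o ≗ o' → firstEmpty o ≡ firstEmpty o'
firstEmpty-cong {zero} _ = refl
firstEmpty-cong {suc n} {o} {o'} o≗o' with o zero | o' zero | o≗o' zero
... | false | _ | refl = refl
... | true  | _ | refl = cong (Data.Maybe.map suc) (firstEmpty-cong (o≗o' ∘ suc))

firstEmptyAfter-cong : ∀ {n} {o o' : Occ n} → o ≗ o' → (a : Fin n) → firstEmptyAfter o a ≡ firstEmptyAfter o' a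
firstEmptyAfter-cong {suc n} o≗o' zero    = cong (Data.Maybe.map suc) (firstEmpty-cong (o≗o' ∘ suc))
firstEmptyAfter-cong {suc n} o≗o' (suc a) = cong (Data.Maybe.map suc) (firstEmptyAfter-cong (o≗o' ∘ suc) a)

chooseSpot-cong : o ≗ o' → (a : Fin n) (c : Bool) → chooseSpot o a c ≡ chooseSpot o' a c
chooseSpot-cong {o = o} {o'} o≗o' a c with o a | o' a | o≗o' a
... | false | _ | refl = refl
... | true  | _ | refl with c
...   | true = firstEmptyAfter-cong o≗o' a
...   | false with prev a
...     | nothing = firstEmptyAfter-cong o≗o' a
...     | just p with o p | o' p | o≗o' p
...       | false | _ | refl = refl
...       | true  | _ | refl = firstEmptyAfter-cong o≗o' a

LeftNeighbour : Fin n → Fin n → Set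
LeftNeighbour p a = suc (toℕ p) ≡ toℕ a

LeftNeighbour-unique : LeftNeighbour p a → LeftNeighbour q a → p ≡ q
LeftNeighbour-unique p⋖a q⋖a = toℕ-injective (ℕ.suc-injective (trans p⋖a (sym q⋖a)))

prev-just : (a : Fin n) → prev a ≡ just p → LeftNeighbour p a
prev-just (suc i) refl = cong suc (toℕ-inject₁ i)

prev-nothing : (a : Fin n) → prev a ≡ nothing → ¬ LeftNeighbour q a
prev-nothing zero _ ()

NoStepBack : Occ n → Fin n → Bool → Set
NoStepBack o a c = c ≡ true ⊎ (∀ p → LeftNeighbour p a → o p ≡ true)

data Chooses {n} (o : Occ n) (a : Fin n) (c : Bool) : Fin n → Set where
  preferred : o a ≡ false → Chooses o a c a
  backward  : o a ≡ true → c ≡ false → LeftNeighbour p a → o p ≡ false → Chooses o a c p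
  forward   : o a ≡ true → NoStepBack o a c → IsFirstEmptyAfter o a s → Chooses o a c s

record Stuck (o : Occ n) (a : Fin n) (c : Bool) : Set where
  constructor stuck
  field
    occupied     : o a ≡ true
    full-after   : FullAfter o a
    no-step-back : NoStepBack o a c

chooses-vacant : Chooses o a c s → o s ≡ false
chooses-vacant (preferred o-a)      = o-a
chooses-vacant (backward _ _ _ o-p) = o-p
chooses-vacant (forward _ _ first)  = vacant first

no-step-back-prev : (o : Occ n) (a : Fin n) → prev a ≡ just p → o p ≡ true → NoStepBack o a false
no-step-back-prev o a prev≡p o-p =
  inj₂ λ q q⋖a → subst (λ k → o k ≡ true) (LeftNeighbour-unique (prev-just a prev≡p) q⋖a) o-p

no-step-back-first : (o : Occ n) (a : Fin n) → prev a ≡ nothing → NoStepBack o a false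
no-step-back-first o a no-prev = inj₂ λ q q⋖a → ⊥-elim (prev-nothing a no-prev q⋖a)

chooseSpot-sound : (o : Occ n) (a : Fin n) (c : Bool) → chooseSpot o a c ≡ just s → Chooses o a c s
chooseSpot-sound o a c eq with o a in o-a
chooseSpot-sound o a c refl | false = preferred o-a
chooseSpot-sound o a true eq | true = forward o-a (inj₁ refl) (firstEmptyAfter-just o a eq)
chooseSpot-sound o a false eq | true with prev a in prev-a
... | nothing = forward o-a (no-step-back-first o a prev-a) (firstEmptyAfter-just o a eq)
... | just p with o p in o-p
chooseSpot-sound o a false refl | true | just p | false = backward o-a refl (prev-just a prev-a) o-p
... | true = forward o-a (no-step-back-prev o a prev-a o-p) (firstEmptyAfter-just o a eq)

chooseSpot-stuck : (o : Occ n) (a : Fin n) (c : Bool) → chooseSpot o a c ≡ nothing → Stuck o a c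
chooseSpot-stuck o a c eq with o a in o-a
chooseSpot-stuck o a c () | false
chooseSpot-stuck o a true eq | true = stuck o-a (firstEmptyAfter-nothing o a eq) (inj₁ refl)
chooseSpot-stuck o a false eq | true with prev a in prev-a
... | nothing = stuck o-a (firstEmptyAfter-nothing o a eq) (no-step-back-first o a prev-a)
... | just p with o p in o-p
chooseSpot-stuck o a false () | true | just p | false
... | true = stuck o-a (firstEmptyAfter-nothing o a eq) (no-step-back-prev o a prev-a o-p)

record Shifted (O O' : Occ n) : Set where
  constructor shifted
  field
    base      : Occ n
    from to   : Fin n
    to≤from   : to ≤ from
    base-from : base from ≡ false
    base-to   : base to ≡ false
    left      : O ≗ update base from
    right     : O' ≗ update base to

shifted-refl : o s ≡ false → o ≗ o' → Shifted (update o s) (update o' s)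
shifted-refl {s = s} o-s o≗o' =
  shifted _ s s ≤-refl o-s o-s (λ _ → refl) (update-cong s (sym ∘ o≗o'))

module Moved {n} {B O O' : Occ n} {x y : Fin n} (y<x : y < x) (B-x : B x ≡ false) (B-y : B y ≡ false)
             (left : O ≗ update B x) (right : O' ≗ update B y) where

  y≢x : y ≢ x
  y≢x = <⇒≢ y<x

  O-x : O x ≡ true
  O-x = trans (left x) (update-updates B x)

  O'-y : O' y ≡ true
  O'-y = trans (right y) (update-updates B y)

  O-away : q ≢ x → O q ≡ B q
  O-away q≢x = trans (left _) (update-minimal B q≢x)

  O'-away : q ≢ y → O' q ≡ B q
  O'-away q≢y = trans (right _) (update-minimal B q≢y)

  O-y : O y ≡ false
  O-y = trans (O-away y≢x) B-y

  O'-x : O' x ≡ false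
  O'-x = trans (O'-away (y≢x ∘ sym)) B-x

  gained-is-y : O' q ≡ true → O q ≡ false → q ≡ y
  gained-is-y {q} O'-q O-q with q ≟ y
  ... | yes q≡y = q≡y
  ... | no q≢y  = ⊥-elim (true≢false O'-q (trans (O'-away q≢y) (trans (sym (O-away q≢x)) O-q)))
    where
    q≢x : q ≢ x
    q≢x refl = true≢false O-x O-q

  lost-is-x : O' q ≡ false → O q ≡ true → q ≡ x
  lost-is-x {q} O'-q O-q with q ≟ x
  ... | yes q≡x = q≡x
  ... | no q≢x  = ⊥-elim (true≢false O-q (trans (O-away q≢x) (trans (sym (O'-away q≢y)) O'-q)))
    where
    q≢y : q ≢ y
    q≢y refl = true≢false O'-y O'-q

  both-park : O s ≡ false → O' s ≡ false → Shifted (update O s) (update O' s)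
  both-park {s} O-s O'-s =
    shifted (update B s) x y (ℕ.<⇒≤ y<x) (trans (update-minimal B x≢s) B-x) (trans (update-minimal B y≢s) B-y)
      (λ k → trans (update-cong s left k) (update-comm B x s k))
      (λ k → trans (update-cong s right k) (update-comm B y s k))
    where
    x≢s : x ≢ s
    x≢s refl = true≢false O-x O-s
    y≢s : y ≢ s
    y≢s refl = true≢false O'-y O'-s

  O-fills-y : O' s' ≡ false → s' ≤ x → Shifted (update O y) (update O' s')
  O-fills-y {s'} O'-s' s'≤x =
    shifted (update B y) x s' s'≤x (trans (update-minimal B (y≢x ∘ sym)) B-x) (trans (sym (right s')) O'-s')
      (λ k → trans (update-cong y left k) (update-comm B x y k))
      (update-cong s' right)

  O'-fills-x : O s ≡ false → y ≤ s → Shifted (update O s) (update O' x)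
  O'-fills-x {s} O-s y≤s =
    shifted (update B x) s y y≤s (trans (sym (left s)) O-s) (trans (update-minimal B y≢x) B-y)
      (update-cong s left)
      (λ k → trans (update-cong x right k) (update-comm B y x k))

  O-fills-y-O'-forward : a < x → IsFirstEmptyAfter O' a s' → Shifted (update O y) (update O' s')
  O-fills-y-O'-forward a<x first = O-fills-y (vacant first) (firstEmptyAfter-minimal first a<x O'-x)

  step : Chooses O a c s → Chooses O' a c s' → Shifted (update O s) (update O' s')
  step (preferred O-a) (preferred O'-a) = both-park O-a O'-a
  step (preferred O-a) (backward O'-a _ p⋖a O'-p) with gained-is-y O'-a O-a
  ... | refl = O-fills-y O'-p (ℕ.<⇒≤ (ℕ.<-trans (ℕ.≤-reflexive p⋖a) y<x))
  step (preferred O-a) (forward O'-a _ first') with gained-is-y O'-a O-a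
  ... | refl = O-fills-y-O'-forward y<x first'
  step (backward O-a _ p⋖a O-p) (preferred O'-a) with lost-is-x O'-a O-a
  ... | refl = O'-fills-x O-p (ℕ.≤-pred (ℕ.≤-trans y<x (ℕ.≤-reflexive (sym p⋖a))))
  step (backward _ _ p⋖a O-p) (backward _ _ p'⋖a O'-p') with LeftNeighbour-unique p⋖a p'⋖a
  ... | refl = both-park O-p O'-p'
  step (backward _ c≡false _ _) (forward _ (inj₁ c≡true) _) = ⊥-elim (true≢false c≡true c≡false)
  step {a = a} (backward _ _ p⋖a O-p) (forward O'-a (inj₂ left-full) first') with gained-is-y (left-full _ p⋖a) O-p
  ... | refl = O-fills-y-O'-forward a<x first'
    where
    a≢x : a ≢ x
    a≢x refl = true≢false O'-a O'-x
    a<x : a < x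
    a<x = ≤∧≢⇒< (ℕ.≤-trans (ℕ.≤-reflexive (sym p⋖a)) y<x) a≢x
  step (forward O-a _ first) (preferred O'-a) with lost-is-x O'-a O-a
  ... | refl = O'-fills-x (vacant first) (ℕ.<⇒≤ (ℕ.<-trans y<x (after first)))
  step (forward _ (inj₁ c≡true) _) (backward _ c≡false _ _) = ⊥-elim (true≢false c≡true c≡false)
  step (forward _ (inj₂ left-full) first) (backward _ _ p⋖a O'-p) with lost-is-x O'-p (left-full _ p⋖a)
  ... | refl = O'-fills-x (vacant first) (ℕ.<⇒≤ (ℕ.<-trans y<x (ℕ.<-trans (ℕ.≤-reflexive p⋖a) (after first))))
  step {s = s} {s' = s'} (forward _ _ first) (forward _ _ first') with <-cmp s s'
  ... | tri≈ _ refl _ = both-park (vacant first) (vacant first')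
  ... | tri< s<s' _ _ with gained-is-y (full-between first' s (after first) s<s') (vacant first)
  ...   | refl = O-fills-y-O'-forward (ℕ.<-trans (after first) y<x) first'
  step {s = s} {s' = s'} (forward _ _ first) (forward _ _ first') | tri> _ _ s'<s
    with lost-is-x (vacant first') (full-between first s' (after first') s'<s)
  ... | refl = O'-fills-x (vacant first) (ℕ.<⇒≤ (ℕ.<-trans y<x s'<s))

  unstuck : Chooses O a c s → ¬ Stuck O' a c
  unstuck (preferred O-a) (stuck O'-a full _) with gained-is-y O'-a O-a
  ... | refl = true≢false (full x y<x) O'-x
  unstuck (backward _ c≡false _ _) (stuck _ _ (inj₁ c≡true)) = true≢false c≡true c≡false
  unstuck (backward _ _ p⋖a O-p) (stuck O'-a full (inj₂ left-full)) with gained-is-y (left-full _ p⋖a) O-p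
  ... | refl with ℕ.m≤n⇒m<n∨m≡n (ℕ.≤-trans (ℕ.≤-reflexive (sym p⋖a)) y<x)
  ...   | inj₁ a<x = true≢false (full x a<x) O'-x
  ...   | inj₂ a≡x with toℕ-injective a≡x
  ...     | refl = true≢false O'-a O'-x
  unstuck (forward _ _ first) (stuck _ full _) with gained-is-y (full _ (after first)) (vacant first)
  ... | refl = true≢false (full x (ℕ.<-trans (after first) y<x)) O'-x

shifted-step : Shifted O O' → chooseSpot O a c ≡ just s →
  ∃ λ s' → chooseSpot O' a c ≡ just s' × Shifted (update O s) (update O' s')
shifted-step {O = O} {O'} {a} {c} {s} (shifted B x y y≤x B-x B-y left right) eq
  with ℕ.m≤n⇒m<n∨m≡n y≤x
... | inj₂ y≡x with toℕ-injective y≡x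
...   | refl = s , trans (sym (chooseSpot-cong O≗O' a c)) eq
                 , shifted-refl (chooses-vacant (chooseSpot-sound O a c eq)) O≗O'
  where
  O≗O' : O ≗ O'
  O≗O' k = trans (left k) (sym (right k))
shifted-step {O = O} {O'} {a} {c} {s} (shifted B x y y≤x B-x B-y left right) eq | inj₁ y<x
  with chooseSpot O' a c in eq'
... | just s' = s' , refl , Moved.step y<x B-x B-y left right (chooseSpot-sound O a c eq) (chooseSpot-sound O' a c eq')
... | nothing = ⊥-elim (Moved.unstuck y<x B-x B-y left right (chooseSpot-sound O a c eq) (chooseSpot-stuck O' a c eq'))

chooseSpot-lower : (o : Occ n) (a : Fin n) → chooseSpot o a true ≡ just s →
  ∃ λ s' → chooseSpot o a false ≡ just s' × Shifted (update o s) (update o s')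
chooseSpot-lower o a eq with o a in o-a
chooseSpot-lower o a refl | false = a , refl , shifted-refl o-a (λ _ → refl)
... | true with prev a in prev-a
... | nothing = _ , eq , shifted-refl (vacant (firstEmptyAfter-just o a eq)) (λ _ → refl)
... | just p with o p in o-p
... | true = _ , eq , shifted-refl (vacant (firstEmptyAfter-just o a eq)) (λ _ → refl)
... | false = p , refl , shifted o _ p p≤s (vacant first) o-p (λ _ → refl) (λ _ → refl)
  where
  first = firstEmptyAfter-just o a eq
  p≤s = ℕ.<⇒≤ (ℕ.<-trans (ℕ.≤-reflexive (prev-just a prev-a)) (after first))

run-shifted : (cars : List (Fin n × Bool)) → Shifted O O' → run O cars ≡ just r →
  ∃ λ r' → run O' cars ≡ just r'
run-shifted [] _ _ = _ , refl
run-shifted {O = O} ((a , c) ∷ cars) sh eq with chooseSpot O a c in e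
run-shifted ((a , c) ∷ cars) sh () | nothing
... | just s with shifted-step sh e
...   | s' , e' , sh' rewrite e' = run-shifted cars sh' eq

data BitLowered {n} : List (Fin n × Bool) → List (Fin n × Bool) → Set where
  here  : ∀ {a cars} → BitLowered ((a , true) ∷ cars) ((a , false) ∷ cars)
  there : ∀ {car cars cars'} → BitLowered cars cars' → BitLowered (car ∷ cars) (car ∷ cars')

run-lowered : BitLowered cars cars' → run o cars ≡ just r → ∃ λ r' → run o cars' ≡ just r'
run-lowered {o = o} (here {a} {cars}) eq with chooseSpot o a true in e
run-lowered here () | nothing
... | just s with chooseSpot-lower o a e
...   | s' , e' , sh rewrite e' = run-shifted cars sh eq
run-lowered {o = o} (there {a , c} lowered) eq with chooseSpot o a c
run-lowered (there lowered) () | nothing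
... | just s = run-lowered lowered eq

carList-cong : ∀ {k} (α : Fin k → Fin (suc m)) {c c' : Fin k → Bool} → c ≗ c' → carList α c ≡ carList α c'
carList-cong {k = zero}  α c≗c' = refl
carList-cong {k = suc k} α c≗c' = cong₂ _∷_ (cong (α zero ,_) (c≗c' zero)) (carList-cong (α ∘ suc) (c≗c' ∘ suc))

carList-lowered : ∀ {k} (α : Fin k → Fin (suc m)) {c c' : Fin k → Bool} (j : Fin k) →
  c j ≡ true → c' j ≡ false → (∀ t → t ≢ j → c t ≡ c' t) → BitLowered (carList α c) (carList α c')
carList-lowered α {c} zero c-j c'-j agree rewrite c-j | c'-j =
  subst (λ cars → BitLowered ((α zero , true) ∷ carList (α ∘ suc) (c ∘ suc)) ((α zero , false) ∷ cars))
    (carList-cong (α ∘ suc) λ t → agree (suc t) λ ())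
    here
carList-lowered α (suc j) c-j c'-j agree rewrite agree zero (λ ()) =
  there (carList-lowered (α ∘ suc) j c-j c'-j λ t t≢j → agree (suc t) (t≢j ∘ suc-injective))

setFalse-updates : (β : Fin m → Bool) (i : Fin m) → setFalse β i i ≡ false
setFalse-updates β i with i ≟ i
... | yes _   = refl
... | no i≢i  = ⊥-elim (i≢i refl)

setFalse-minimal : (β : Fin m → Bool) (i j : Fin m) → j ≢ i → setFalse β i j ≡ β j
setFalse-minimal β i j j≢i with i ≟ j
... | yes i≡j = ⊥-elim (j≢i (sym i≡j))
... | no _    = refl

lemma6 : (m : ℕ) (α : Fin (suc m) → Fin (suc m)) (β : Fin m → Bool) (i : Fin m) →
    Parks α β → β i ≡ true → Parks α (setFalse β i)
lemma6 m α β i (_ , parks) β-i =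
  run-lowered {o = empty} (carList-lowered α (suc i) β-i (setFalse-updates β i) unchanged) parks
  where
  unchanged : ∀ t → t ≢ suc i → bitOf β t ≡ bitOf (setFalse β i) t
  unchanged zero    _     = refl
  unchanged (suc t) t≢1+i = sym (setFalse-minimal β i t (t≢1+i ∘ cong suc))
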